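{- Work in $\mathbf{CZF}$. Full NID implies that for every set $P$ of propositional letters and every game theory $T$ over $P$, the minimal models of $T$ (minimal with respect to inclusion of subsets of $P$) form a set. Likewise, finitary NID implies this for finitary game theories, and elementary NID implies this for elementary game theories.
   Context: A game formula over a set $P$ of propositional letters is built from letters in $P$ using set-indexed infinitary disjunctions and conjunctions, with no implications or negations. A game sequent is $\varphi\to\psi$ with $\varphi,\psi$ game formulas; a game theory is a set of game sequents. A game formula is finitary if all its conjunctions are indexed by finite sets (images of some $\{1,\dots,n\}$), and elementary if it contains no conjunctions; a finitary (elementary) game theory is a set of sequents whose hypotheses are finitary (elementary). A model is a subset $M\subseteq P$ with the evident satisfaction relation ($M\models p$ iff $p\in M$; conjunctions/disjunctions interpreted as all/some; $M\models T$ iff each sequent's hypothesis implies its conclusion in $M$). A rule on a set $X$ is a pair $(a,b)$ of subsets of $X$, elementary if $a$ is a singleton, finitary if $a$ finite; $Y\subseteq X$ is closed under it if $a\subseteq Y$ implies $b\cap Y$ inhabited. A class $\mathcal M$ of subsets of $X$ is set-generated if there is a set $G\subseteq\mathcal M$ with $\forall\alpha\in\mathcal M\,\forall x\in\alpha\,\exists\beta\in G\,x\in\beta\subseteq\alpha$. Full NID: for every set $X$ and set $\mathcal R$ of rules on $X$, the class of subsets closed under all rules in $\mathcal R$ is set-generated; finitary (elementary) NID restricts to finitary (elementary) rules. -}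

module Defs where

open import Level using (Level; 0ℓ)
open import Data.Nat using (ℕ)
open import Data.Fin using (Fin)
open import Data.Product using (Σ; _×_; _,_; ∃)
open import Relation.Binary.PropositionalEquality using (_≡_)
open import Function.Bundles using (_⇔_)

-- "Sets" of CZF are read as small types (Set); a subset of a set X is a
-- small predicate X → Set, and subsets are compared extensionally.

Subset : Set → Set₁
Subset X = X → Set

_⊆_ : {X : Set} → Subset X → Subset X → Set
_⊆_ {X} A B = ∀ (x : X) → A x → B x

_≐_ : {X : Set} → Subset X → Subset X → Set
A ≐ B = (A ⊆ B) × (B ⊆ A)

IsFiniteSet : Set → Set
IsFiniteSet I = Σ ℕ λ n → Σ (Fin n → I) λ f → ∀ (i : I) → Σ (Fin n) λ k → f k ≡ i

IsFiniteSubset : {X : Set} → Subset X → Set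
IsFiniteSubset {X} a =
  Σ ℕ λ n → Σ (Fin n → X) λ f → ∀ (x : X) → a x ⇔ (Σ (Fin n) λ k → f k ≡ x)

IsSingleton : {X : Set} → Subset X → Set
IsSingleton {X} a = Σ X λ x₀ → ∀ (x : X) → a x ⇔ (x ≡ x₀)

data GameFormula (P : Set) : Set₁ where
  atom : P → GameFormula P
  ⋁    : (I : Set) → (I → GameFormula P) → GameFormula P
  ⋀    : (I : Set) → (I → GameFormula P) → GameFormula P

data Finitary {P : Set} : GameFormula P → Set₁ where
  atom-fin : (p : P) → Finitary (atom p)
  ⋁-fin    : (I : Set) (φ : I → GameFormula P) →
             (∀ i → Finitary (φ i)) → Finitary (⋁ I φ)
  ⋀-fin    : (I : Set) (φ : I → GameFormula P) → IsFiniteSet I →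
             (∀ i → Finitary (φ i)) → Finitary (⋀ I φ)

data Elementary {P : Set} : GameFormula P → Set₁ where
  atom-el : (p : P) → Elementary (atom p)
  ⋁-el    : (I : Set) (φ : I → GameFormula P) →
            (∀ i → Elementary (φ i)) → Elementary (⋁ I φ)

record GameSequent (P : Set) : Set₁ where
  constructor _⟶_
  field
    hyp  : GameFormula P
    conc : GameFormula P
open GameSequent public

record GameTheory (P : Set) : Set₁ where
  field
    Idx : Set
    seq : Idx → GameSequent P
open GameTheory public

FinitaryTheory : {P : Set} → GameTheory P → Set₁
FinitaryTheory T = ∀ i → Finitary (hyp (seq T i))

ElementaryTheory : {P : Set} → GameTheory P → Set₁
ElementaryTheory T = ∀ i → Elementary (hyp (seq T i))

_⊨_ : {P : Set} → Subset P → GameFormula P → Set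
M ⊨ atom p  = M p
M ⊨ ⋁ I φ   = Σ I λ i → M ⊨ φ i
M ⊨ ⋀ I φ   = ∀ (i : I) → M ⊨ φ i

_⊨T_ : {P : Set} → Subset P → GameTheory P → Set
M ⊨T T = ∀ (i : Idx T) → M ⊨ hyp (seq T i) → M ⊨ conc (seq T i)

IsMinimalModel : {P : Set} → GameTheory P → Subset P → Set₁
IsMinimalModel {P} T M =
  (M ⊨T T) × (∀ (N : Subset P) → N ⊨T T → N ⊆ M → M ⊆ N)

-- The class of minimal models of T forms a set: it is (up to extensional
-- equality of subsets) exactly the image of a family indexed by a set.
MinimalModelsFormASet : {P : Set} → GameTheory P → Set₁
MinimalModelsFormASet {P} T =
  Σ Set λ I → Σ (I → Subset P) λ m →
    (∀ (i : I) → IsMinimalModel T (m i)) ×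
    (∀ (M : Subset P) → IsMinimalModel T M → Σ I λ i → M ≐ m i)

record Rule (X : Set) : Set₁ where
  constructor rule
  field
    premises    : Subset X
    conclusions : Subset X
open Rule public

ClosedUnder : {X : Set} → Subset X → Rule X → Set
ClosedUnder {X} Y r =
  premises r ⊆ Y → Σ X λ x → conclusions r x × Y x

ClosedUnderAll : {X : Set} (R : Set) → (R → Rule X) → Subset X → Set
ClosedUnderAll R rs Y = ∀ (k : R) → ClosedUnder Y (rs k)

SetGenerated : {X : Set} → (Subset X → Set) → Set₁
SetGenerated {X} 𝓜 =
  Σ Set λ G → Σ (G → Subset X) λ g →
    (∀ (j : G) → 𝓜 (g j)) ×
    (∀ (α : Subset X) → 𝓜 α → ∀ (x : X) → α x →
       Σ G λ j → g j x × g j ⊆ α)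

NIDFor : (∀ {X : Set} → Rule X → Set) → Set₁
NIDFor Allowed =
  ∀ (X : Set) (R : Set) (rs : R → Rule X) → (∀ k → Allowed (rs k)) →
    SetGenerated (ClosedUnderAll R rs)

FullNID : Set₁
FullNID = ∀ (X : Set) (R : Set) (rs : R → Rule X) →
  SetGenerated (ClosedUnderAll R rs)

FinitaryNID : Set₁
FinitaryNID = NIDFor (λ r → IsFiniteSubset (premises r))

ElementaryNID : Set₁
ElementaryNID = NIDFor (λ r → IsSingleton (premises r))

-- Encode T as a rule system on P ⊎ (⊤ ⊎ positions in the conclusions): a
-- choice of disjuncts in a hypothesis becomes a rule from the atoms it needs
-- to the root of the conclusion, and each position of a conclusion becomes a
-- rule unfolding one connective (one rule offering all disjuncts, or one rule
-- per conjunct).  Closed sets restrict to models of T, and every model M is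
-- the restriction of a closed set.  NID then yields a set of models below
-- every model, and the minimal ones among them are exactly the minimal models.
-- Hypotheses only contribute premises, so finitary (elementary) hypotheses
-- give finitary (elementary) rules.
module Submission where

open import Defs
open import Data.Product using (_×_; Σ; _,_; proj₁; proj₂)
open import Data.Sum using (_⊎_; inj₁; inj₂)
open import Data.Maybe using (Maybe; just; nothing)
open import Data.Unit using (⊤; tt)
open import Data.Fin using (Fin; zero)
open import Data.List using (List; []; _∷_; length; lookup; concatMap; allFin)
open import Data.List.Membership.Propositional using (_∈_; lose)
open import Data.List.Membership.Propositional.Properties
  using (∈-lookup; ∈-concatMap⁺; ∈-concatMap⁻; ∈-allFin)
open import Data.List.Relation.Unary.Any using (here; index; satisfied)
open import Data.List.Relation.Unary.Any.Properties using (lookup-index)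
open import Relation.Binary.PropositionalEquality using (_≡_; refl; sym; cong)
open import Function using (_∘_; id)
open import Function.Bundles using (_⇔_; mk⇔; Equivalence)

module _ {P : Set} where

  Minimal : (Subset P → Set) → Subset P → Set₁
  Minimal 𝓜 M = 𝓜 M × (∀ N → 𝓜 N → N ⊆ M → M ⊆ N)

  Coinitial : (Subset P → Set) → Set₁
  Coinitial 𝓜 =
    Σ Set λ G → Σ (G → Subset P) λ g →
      (∀ j → 𝓜 (g j)) × (∀ M → 𝓜 M → Σ G λ j → g j ⊆ M)

  MinimalsFormASet : (Subset P → Set) → Set₁
  MinimalsFormASet 𝓜 =
    Σ Set λ I → Σ (I → Subset P) λ m →
      (∀ i → Minimal 𝓜 (m i)) × (∀ M → Minimal 𝓜 M → Σ I λ i → M ≐ m i)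

  minimals-formASet : {𝓜 : Subset P → Set} → Coinitial 𝓜 → MinimalsFormASet 𝓜
  minimals-formASet {𝓜} (G , g , g∈𝓜 , below) = I , m , minimal , cover
    where
    I : Set
    I = Σ G λ j → ∀ j′ → g j′ ⊆ g j → g j ⊆ g j′

    m : I → Subset P
    m = g ∘ proj₁

    minimal : ∀ i → Minimal 𝓜 (m i)
    minimal (j , least) = g∈𝓜 j , λ N N∈𝓜 N⊆gj →
      let (j′ , gj′⊆N) = below N N∈𝓜
      in λ p p∈gj → gj′⊆N p (least j′ (λ q → N⊆gj q ∘ gj′⊆N q) p p∈gj)

    cover : ∀ M → Minimal 𝓜 M → Σ I λ i → M ≐ m i
    cover M (M∈𝓜 , M-min) =
      let (j , gj⊆M) = below M M∈𝓜
      in (j , λ j′ gj′⊆gj p →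
               M-min (g j′) (g∈𝓜 j′) (λ q → gj⊆M q ∘ gj′⊆gj q) p ∘ gj⊆M p)
         , M-min (g j) (g∈𝓜 j) gj⊆M , gj⊆M

coinitial-restriction :
  {X P : Set} {𝓒 : Subset X → Set} {𝓜 : Subset P → Set} (e : P → X) (x₀ : X) →
  (∀ Y → 𝓒 Y → 𝓜 (Y ∘ e)) →
  (∀ M → 𝓜 M → Σ (Subset X) λ Y → 𝓒 Y × Y x₀ × (Y ∘ e) ⊆ M) →
  SetGenerated 𝓒 → Coinitial 𝓜
coinitial-restriction e x₀ restrict extend (G , g , g∈𝓒 , generate) =
  G , (λ j → g j ∘ e) , (λ j → restrict (g j) (g∈𝓒 j)) , λ M M∈𝓜 →
    let (Y , Y∈𝓒 , x₀∈Y , Y⊆M) = extend M M∈𝓜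
        (j , _ , gj⊆Y) = generate Y Y∈𝓒 x₀ x₀∈Y
    in j , λ p → Y⊆M p ∘ gj⊆Y (e p)

Listable : {X : Set} → Subset X → Set
Listable {X} a = Σ (List X) λ xs → ∀ x → a x ⇔ x ∈ xs

listable-singleton : {X : Set} (x₀ : X) → Listable (_≡ x₀)
listable-singleton x₀ = x₀ ∷ [] , λ x → mk⇔ (λ { refl → here refl }) λ { (here x≡x₀) → x≡x₀ }

listable-⋃ : {X I : Set} {a : I → Subset X} → IsFiniteSet I → (∀ i → Listable (a i)) →
             Listable (λ x → Σ I λ i → a i x)
listable-⋃ {a = a} (n , e , e-onto) listed =
  concatMap list (allFin n) , λ x → mk⇔ (into x) (out-of x)
  where
  list : Fin n → List _
  list = proj₁ ∘ listed ∘ e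

  into : ∀ x → (Σ _ λ i → a i x) → x ∈ concatMap list (allFin n)
  into x (i , x∈ai) with e-onto i
  ... | k , refl =
    ∈-concatMap⁺ list (lose (∈-allFin k) (Equivalence.to (proj₂ (listed i) x) x∈ai))

  out-of : ∀ x → x ∈ concatMap list (allFin n) → Σ _ λ i → a i x
  out-of x x∈xs =
    let (k , x∈list-k) = satisfied (∈-concatMap⁻ list {xs = allFin n} x∈xs)
    in e k , Equivalence.from (proj₂ (listed (e k)) x) x∈list-k

listable⇒finite : {X : Set} {a : Subset X} → Listable a → IsFiniteSubset a
listable⇒finite (xs , a⇔∈) = length xs , lookup xs , λ x → mk⇔
  (λ x∈a → let x∈xs = Equivalence.to (a⇔∈ x) x∈a in index x∈xs , sym (lookup-index x∈xs))
  (λ { (k , refl) → Equivalence.from (a⇔∈ _) (∈-lookup k) })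

singleton⇒finite : {X : Set} {a : Subset X} → IsSingleton a → IsFiniteSubset a
singleton⇒finite (x₀ , a⇔≡) = 1 , (λ _ → x₀) , λ x → mk⇔
  (λ x∈a → zero , sym (Equivalence.to (a⇔≡ x) x∈a))
  (λ { (_ , refl) → Equivalence.from (a⇔≡ x₀) refl })

≡-singleton : {X : Set} (x₀ : X) → IsSingleton (_≡ x₀)
≡-singleton x₀ = x₀ , λ _ → mk⇔ id id

image : {A B : Set} → (A → B) → Subset A → Subset B
image {A} f a y = Σ A λ x → f x ≡ y × a x

finite-image : {A B : Set} (f : A → B) {a : Subset A} → IsFiniteSubset a →
               IsFiniteSubset (image f a)
finite-image f (n , g , a⇔im) = n , f ∘ g , λ y → mk⇔
  (λ { (x , refl , x∈a) → let (k , gk≡x) = Equivalence.to (a⇔im x) x∈a in k , cong f gk≡x })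
  (λ { (k , refl) → g k , refl , Equivalence.from (a⇔im (g k)) (k , refl) })

singleton-image : {A B : Set} (f : A → B) {a : Subset A} → IsSingleton a →
                  IsSingleton (image f a)
singleton-image f (x₀ , a⇔≡) = f x₀ , λ y → mk⇔
  (λ { (x , refl , x∈a) → cong f (Equivalence.to (a⇔≡ x) x∈a) })
  (λ { refl → x₀ , refl , Equivalence.from (a⇔≡ x₀) refl })

module _ {P : Set} where

  private
    F : Set₁
    F = GameFormula P

  -- A choice picks one disjunct at every ⋁; positive formulas are the
  -- disjunctions, over all choices, of the conjunction of their supports.
  Choice : F → Set
  Choice (atom p)  = ⊤
  Choice (⋁ I φ)   = Σ I λ i → Choice (φ i)
  Choice (⋀ I φ)   = (i : I) → Choice (φ i)

  support : (φ : F) → Choice φ → Subset P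
  support (atom p) _       = _≡ p
  support (⋁ I φ) (i , c)  = support (φ i) c
  support (⋀ I φ) c q      = Σ I λ i → support (φ i) (c i) q

  ⊨⇒choice : (M : Subset P) (φ : F) → M ⊨ φ → Σ (Choice φ) λ c → support φ c ⊆ M
  ⊨⇒choice M (atom p) p∈M = tt , λ { _ refl → p∈M }
  ⊨⇒choice M (⋁ I φ) (i , M⊨φi) =
    let (c , c⊆M) = ⊨⇒choice M (φ i) M⊨φi in (i , c) , c⊆M
  ⊨⇒choice M (⋀ I φ) M⊨φ =
    (λ i → proj₁ (⊨⇒choice M (φ i) (M⊨φ i))) ,
    λ { q (i , q∈ci) → proj₂ (⊨⇒choice M (φ i) (M⊨φ i)) q q∈ci }

  choice⇒⊨ : (M : Subset P) (φ : F) (c : Choice φ) → support φ c ⊆ M → M ⊨ φ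
  choice⇒⊨ M (atom p) _ c⊆M        = c⊆M p refl
  choice⇒⊨ M (⋁ I φ) (i , c) c⊆M  = i , choice⇒⊨ M (φ i) c c⊆M
  choice⇒⊨ M (⋀ I φ) c c⊆M i      = choice⇒⊨ M (φ i) (c i) (λ q → c⊆M q ∘ (i ,_))

  listable-support : (φ : F) → Finitary φ → (c : Choice φ) → Listable (support φ c)
  listable-support (atom p) _ _                      = listable-singleton p
  listable-support (⋁ I φ) (⋁-fin _ _ fin) (i , c)   = listable-support (φ i) (fin i) c
  listable-support (⋀ I φ) (⋀-fin _ _ I-fin fin) c  =
    listable-⋃ I-fin λ i → listable-support (φ i) (fin i) (c i)

  singleton-support : (φ : F) → Elementary φ → (c : Choice φ) → IsSingleton (support φ c)
  singleton-support (atom p) _ _                    = ≡-singleton p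
  singleton-support (⋁ I φ) (⋁-el _ _ el) (i , c)  = singleton-support (φ i) (el i) c

  Pos : F → Set
  Pos (atom p) = ⊤
  Pos (⋁ I φ)  = Maybe (Σ I λ i → Pos (φ i))
  Pos (⋀ I φ)  = Maybe (Σ I λ i → Pos (φ i))

  Pos⁺ : {I : Set} → (I → F) → Set
  Pos⁺ {I} φ = Maybe (Σ I λ i → Pos (φ i))

  root : (ψ : F) → Pos ψ
  root (atom p) = tt
  root (⋁ I φ)  = nothing
  root (⋀ I φ)  = nothing

  subformula : (ψ : F) → Pos ψ → F
  subformula (atom p) _               = atom p
  subformula (⋁ I φ) nothing          = ⋁ I φ
  subformula (⋁ I φ) (just (i , π))   = subformula (φ i) π
  subformula (⋀ I φ) nothing          = ⋀ I φ
  subformula (⋀ I φ) (just (i , π))   = subformula (φ i) π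

  ⊨-root : (M : Subset P) (ψ : F) → M ⊨ ψ → M ⊨ subformula ψ (root ψ)
  ⊨-root M (atom p) = id
  ⊨-root M (⋁ I φ)  = id
  ⊨-root M (⋀ I φ)  = id

  child : {I : Set} (φ : I → F) (i : I) → Pos (φ i) ⊎ P → Pos⁺ φ ⊎ P
  child φ i (inj₁ π) = inj₁ (just (i , π))
  child φ i (inj₂ p) = inj₂ p

  -- The rules of ψ act on Pos ψ ⊎ P; each fires at one position and either
  -- unfolds the connective there (inj₁) or is a rule of a child (inj₂).
  LocalRule : F → Set
  LocalRule (atom p) = ⊤
  LocalRule (⋁ I φ)  = ⊤ ⊎ Σ I λ i → LocalRule (φ i)
  LocalRule (⋀ I φ)  = I ⊎ Σ I λ i → LocalRule (φ i)

  trigger : (ψ : F) → LocalRule ψ → Pos ψ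
  trigger (atom p) _               = tt
  trigger (⋁ I φ) (inj₁ _)         = nothing
  trigger (⋁ I φ) (inj₂ (i , r))   = just (i , trigger (φ i) r)
  trigger (⋀ I φ) (inj₁ _)         = nothing
  trigger (⋀ I φ) (inj₂ (i , r))   = just (i , trigger (φ i) r)

  outcome : (ψ : F) → LocalRule ψ → Subset (Pos ψ ⊎ P)
  outcome (atom p) _ = _≡ inj₂ p
  outcome (⋁ I φ) (inj₁ _) z       = Σ I λ i → z ≡ inj₁ (just (i , root (φ i)))
  outcome (⋁ I φ) (inj₂ (i , r))   = image (child φ i) (outcome (φ i) r)
  outcome (⋀ I φ) (inj₁ i)         = _≡ inj₁ (just (i , root (φ i)))
  outcome (⋀ I φ) (inj₂ (i , r))   = image (child φ i) (outcome (φ i) r)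

  LocallyClosed : (ψ : F) → Subset (Pos ψ ⊎ P) → Set
  LocallyClosed ψ Z = ∀ r → Z (inj₁ (trigger ψ r)) → Σ _ λ z → outcome ψ r z × Z z

  closed-child : {I : Set} (φ : I → F) (i : I) (Z : Subset (Pos⁺ φ ⊎ P)) →
    (∀ r → Z (inj₁ (just (i , trigger (φ i) r))) →
       Σ _ λ z → image (child φ i) (outcome (φ i) r) z × Z z) →
    LocallyClosed (φ i) (Z ∘ child φ i)
  closed-child φ i Z closed r fired with closed r fired
  ... | _ , (z , refl , z∈out) , z∈Z = z , z∈out , z∈Z

  closed⇒⊨ : (ψ : F) (Z : Subset (Pos ψ ⊎ P)) → LocallyClosed ψ Z →
             Z (inj₁ (root ψ)) → (Z ∘ inj₂) ⊨ ψ
  closed⇒⊨ (atom p) Z closed root∈Z with closed tt root∈Z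
  ... | _ , refl , p∈Z = p∈Z
  closed⇒⊨ (⋁ I φ) Z closed root∈Z with closed (inj₁ tt) root∈Z
  ... | _ , (i , refl) , z∈Z =
    i , closed⇒⊨ (φ i) (Z ∘ child φ i) (closed-child φ i Z (closed ∘ inj₂ ∘ (i ,_))) z∈Z
  closed⇒⊨ (⋀ I φ) Z closed root∈Z i with closed (inj₁ i) root∈Z
  ... | _ , refl , z∈Z =
    closed⇒⊨ (φ i) (Z ∘ child φ i) (closed-child φ i Z (closed ∘ inj₂ ∘ (i ,_))) z∈Z

  truth : Subset P → (ψ : F) → Subset (Pos ψ ⊎ P)
  truth M ψ (inj₁ π) = M ⊨ subformula ψ π
  truth M ψ (inj₂ p) = M p

  truth-child-⋁ : (M : Subset P) {I : Set} (φ : I → F) (i : I) (z : Pos (φ i) ⊎ P) →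
                  truth M (φ i) z → truth M (⋁ I φ) (child φ i z)
  truth-child-⋁ M φ i (inj₁ π) = id
  truth-child-⋁ M φ i (inj₂ p) = id

  truth-child-⋀ : (M : Subset P) {I : Set} (φ : I → F) (i : I) (z : Pos (φ i) ⊎ P) →
                  truth M (φ i) z → truth M (⋀ I φ) (child φ i z)
  truth-child-⋀ M φ i (inj₁ π) = id
  truth-child-⋀ M φ i (inj₂ p) = id

  truth-closed : (M : Subset P) (ψ : F) → LocallyClosed ψ (truth M ψ)
  truth-closed M (atom p) _ p∈M = inj₂ p , refl , p∈M
  truth-closed M (⋁ I φ) (inj₁ _) (i , M⊨φi) =
    inj₁ (just (i , root (φ i))) , (i , refl) , ⊨-root M (φ i) M⊨φi
  truth-closed M (⋁ I φ) (inj₂ (i , r)) fired =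
    let (z , z∈out , z-true) = truth-closed M (φ i) r fired
    in child φ i z , (z , refl , z∈out) , truth-child-⋁ M φ i z z-true
  truth-closed M (⋀ I φ) (inj₁ i) M⊨φ =
    inj₁ (just (i , root (φ i))) , refl , ⊨-root M (φ i) (M⊨φ i)
  truth-closed M (⋀ I φ) (inj₂ (i , r)) fired =
    let (z , z∈out , z-true) = truth-closed M (φ i) r fired
    in child φ i z , (z , refl , z∈out) , truth-child-⋀ M φ i z z-true

module Encoding {P : Set} (T : GameTheory P) where

  private
    H C : Idx T → GameFormula P
    H k = hyp (seq T k)
    C k = conc (seq T k)

  Node : Set
  Node = Σ (Idx T) λ k → Pos (C k)

  -- The extra point ⊤ lies in every closure of a model, so the generators
  -- below such a closure can be requested even when the model is empty.
  X : Set
  X = P ⊎ (⊤ ⊎ Node)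

  at : (k : Idx T) → Pos (C k) ⊎ P → X
  at k (inj₁ π) = inj₂ (inj₂ (k , π))
  at k (inj₂ p) = inj₁ p

  Rules : Set
  Rules = (Σ (Idx T) λ k → Choice (H k)) ⊎ (Σ (Idx T) λ k → LocalRule (C k))

  rules : Rules → Rule X
  rules (inj₁ (k , c)) = rule (image inj₁ (support (H k) c)) (_≡ at k (inj₁ (root (C k))))
  rules (inj₂ (k , r)) = rule (_≡ at k (inj₁ (trigger (C k) r))) (image (at k) (outcome (C k) r))

  Closed : Subset X → Set
  Closed = ClosedUnderAll Rules rules

  closed⇒locallyClosed : (Y : Subset X) → Closed Y → ∀ k → LocallyClosed (C k) (Y ∘ at k)
  closed⇒locallyClosed Y closed k r fired with closed (inj₂ (k , r)) (λ { _ refl → fired })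
  ... | _ , (z , refl , z∈out) , z∈Y = z , z∈out , z∈Y

  closed⇒model : (Y : Subset X) → Closed Y → (Y ∘ inj₁) ⊨T T
  closed⇒model Y closed k Y⊨Hk with ⊨⇒choice (Y ∘ inj₁) (H k) Y⊨Hk
  ... | c , c⊆Y with closed (inj₁ (k , c)) (λ { _ (q , refl , q∈c) → c⊆Y q q∈c })
  ... | _ , refl , root∈Y = closed⇒⊨ (C k) (Y ∘ at k) (closed⇒locallyClosed Y closed k) root∈Y

  closure : Subset P → Subset X
  closure M (inj₁ p)              = M p
  closure M (inj₂ (inj₁ _))       = ⊤
  closure M (inj₂ (inj₂ (k , π))) = M ⊨ subformula (C k) π

  closure-at : (M : Subset P) (k : Idx T) (z : Pos (C k) ⊎ P) →
               truth M (C k) z → closure M (at k z)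
  closure-at M k (inj₁ π) = id
  closure-at M k (inj₂ p) = id

  model⇒closed : (M : Subset P) → M ⊨T T → Closed (closure M)
  model⇒closed M M⊨T (inj₁ (k , c)) c⊆closure =
    at k (inj₁ (root (C k))) , refl ,
    ⊨-root M (C k) (M⊨T k (choice⇒⊨ M (H k) c λ q q∈c → c⊆closure (inj₁ q) (q , refl , q∈c)))
  model⇒closed M M⊨T (inj₂ (k , r)) fired⊆closure =
    let (z , z∈out , z-true) = truth-closed M (C k) r (fired⊆closure _ refl)
    in at k z , (z , refl , z∈out) , closure-at M k z z-true

  minimalModels : SetGenerated Closed → MinimalModelsFormASet T
  minimalModels =
    minimals-formASet ∘
    coinitial-restriction inj₁ (inj₂ (inj₁ tt)) closed⇒model
      (λ M M⊨T → closure M , model⇒closed M M⊨T , tt , λ _ → id)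

  finitary-rules : FinitaryTheory T → ∀ k → IsFiniteSubset (premises (rules k))
  finitary-rules fin (inj₁ (k , c)) =
    finite-image inj₁ (listable⇒finite (listable-support (H k) (fin k) c))
  finitary-rules fin (inj₂ (k , r)) = singleton⇒finite (≡-singleton _)

  elementary-rules : ElementaryTheory T → ∀ k → IsSingleton (premises (rules k))
  elementary-rules el (inj₁ (k , c)) = singleton-image inj₁ (singleton-support (H k) (el k) c)
  elementary-rules el (inj₂ (k , r)) = ≡-singleton _

corollary4p3 :
    (FullNID → ∀ (P : Set) (T : GameTheory P) → MinimalModelsFormASet T)
    × (FinitaryNID → ∀ (P : Set) (T : GameTheory P) →
         FinitaryTheory T → MinimalModelsFormASet T)
    × (ElementaryNID → ∀ (P : Set) (T : GameTheory P) →
         ElementaryTheory T → MinimalModelsFormASet T)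
corollary4p3 =
  (λ nid P T → let open Encoding T in minimalModels (nid X Rules rules)) ,
  (λ nid P T fin → let open Encoding T in
     minimalModels (nid X Rules rules (finitary-rules fin))) ,
  (λ nid P T el → let open Encoding T in
     minimalModels (nid X Rules rules (elementary-rules el)))
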